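{- Let $F=\mathbb{Q}(\sqrt{ -1})$. There exists a Hermitian lattice $(L,\langle\ ,\ \rangle)$ over $\mathscr{O}_F$ of signature $(1,4)$ such that the associated quadratic lattice satisfies $L_Q\cong\mathbb{U}\oplus\mathbb{U}\oplus\mathbb{D}_6(-1)$, and such that $2\langle\ell,r\rangle\in\mathscr{O}_F$ for all $\ell,r\in L$ with $\langle r,r\rangle=-1$.
   Context: $\mathscr{O}_F=\mathbb{Z}[\sqrt{ -1}]$, with a fixed embedding $F\hookrightarrow\mathbb{C}$. A Hermitian lattice over $\mathscr{O}_F$ is a projective $\mathscr{O}_F$-module $L$ (here of rank 5) with a Hermitian form $\langle\ ,\ \rangle\colon L\times L\to F$ such that $\mathrm{Tr}_{F/\mathbb{Q}}\langle x,x\rangle\in\mathbb{Z}$ for all $x$. $L_Q$ is $L$ as a free $\mathbb{Z}$-module with $(x,y)=\mathrm{Tr}_{F/\mathbb{Q}}\langle x,y\rangle$, of signature $(2,8)$. $\mathbb{U}$ is the hyperbolic plane, $\mathbb{D}_6$ the positive definite $D_6$ root lattice, and $M(-1)$ is $M$ with its form negated. -}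

module Defs where

open import Data.Nat as ℕ using (ℕ; zero; suc)
open import Data.Fin using (Fin; zero; suc; toℕ; splitAt)
open import Data.Sum using (_⊎_; inj₁; inj₂)
open import Data.Bool using (Bool; true; false; if_then_else_)
open import Data.Integer as ℤ using (ℤ; +_)
open import Data.Rational as ℚ using (ℚ; 0ℚ; 1ℚ; _/_)
open import Data.Product using (Σ; ∃; _×_; _,_)
open import Relation.Binary.PropositionalEquality using (_≡_; _≢_)

Mat : Set → ℕ → ℕ → Set
Mat A m n = Fin m → Fin n → A

sumWith : {A : Set} → A → (A → A → A) → {n : ℕ} → (Fin n → A) → A
sumWith z _⊕_ {zero}  f = z
sumWith z _⊕_ {suc n} f = f zero ⊕ sumWith z _⊕_ (λ i → f (suc i))

ℤsum : {n : ℕ} → (Fin n → ℤ) → ℤ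
ℤsum = sumWith (+ 0) ℤ._+_

ℚsum : {n : ℕ} → (Fin n → ℚ) → ℚ
ℚsum = sumWith 0ℚ ℚ._+_

ℤ→ℚ : ℤ → ℚ
ℤ→ℚ z = z / 1

IsInt : ℚ → Set
IsInt q = ∃ λ (z : ℤ) → q ≡ ℤ→ℚ z

infix 5 _+i_ _+iℤ_

record F : Set where
  constructor _+i_
  field
    re : ℚ
    im : ℚ
open F public

0F : F
0F = 0ℚ +i 0ℚ

1F : F
1F = 1ℚ +i 0ℚ

infixl 6 _+F_
infixl 7 _*F_
_+F_ : F → F → F
(a +i b) +F (c +i d) = (a ℚ.+ c) +i (b ℚ.+ d)

_*F_ : F → F → F
(a +i b) *F (c +i d) = ((a ℚ.* c) ℚ.- (b ℚ.* d)) +i ((a ℚ.* d) ℚ.+ (b ℚ.* c))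

conj : F → F
conj (a +i b) = a +i (ℚ.- b)

Fsum : {n : ℕ} → (Fin n → F) → F
Fsum = sumWith 0F _+F_

-- Tr_{F/ℚ} z = z + z̄ = 2 Re z
Tr : F → ℚ
Tr z = re z ℚ.+ re z

minus1F : F
minus1F = ℚ.- 1ℚ +i 0ℚ

2F : F
2F = 1F +F 1F

InOF : F → Set
InOF z = IsInt (re z) × IsInt (im z)

record 𝒪F : Set where
  constructor _+iℤ_
  field
    reℤ : ℤ
    imℤ : ℤ
open 𝒪F public

ι : 𝒪F → F
ι (a +iℤ b) = ℤ→ℚ a +i ℤ→ℚ b

herm : {n : ℕ} → Mat F n n → (Fin n → F) → (Fin n → F) → F
herm H x y = Fsum λ i → Fsum λ j → x i *F H i j *F conj (y j)

IsHermitianMatrix : {n : ℕ} → Mat F n n → Set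
IsHermitianMatrix H = ∀ i j → H j i ≡ conj (H i j)

-- the lattice L = 𝒪_F^n (every f.g. projective 𝒪_F-module is free)
Lvec : ℕ → Set
Lvec n = Fin n → 𝒪F

emb : {n : ℕ} → Lvec n → (Fin n → F)
emb x i = ι (x i)

IsHermitianLattice : {n : ℕ} → Mat F n n → Set
IsHermitianLattice H = ∀ x → IsInt (Tr (herm H (emb x) (emb x)))

-- F-linear independence / basis of F^n: the matrix with columns v k is invertible
IsFBasis : {n : ℕ} → (Fin n → Fin n → F) → Set
IsFBasis {n} v = Σ (Mat F n n) λ N →
  ∀ i j → Fsum (λ k → v k i *F N k j) ≡ (if ⌊eq⌋ i j then 1F else 0F)
  where
  ⌊eq⌋ : {m : ℕ} → Fin m → Fin m → Bool
  ⌊eq⌋ zero zero = true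
  ⌊eq⌋ (suc a) (suc b) = ⌊eq⌋ a b
  ⌊eq⌋ _ _ = false

-- Signature (p , q) of the Hermitian form (p + q = rank):
-- there is an F-basis in which the Gram matrix is diagonal with
-- p positive entries followed by q negative entries (Sylvester).
HasSignature : (p q : ℕ) → Mat F (p ℕ.+ q) (p ℕ.+ q) → Set
HasSignature p q H = Σ (Fin (p ℕ.+ q) → Fin (p ℕ.+ q) → F) λ v →
  IsFBasis v ×
  (∀ k l → k ≢ l → herm H (v k) (v l) ≡ 0F) ×
  (∀ k → im (herm H (v k) (v k)) ≡ 0ℚ) ×
  (∀ k → (toℕ k ℕ.< p → 0ℚ ℚ.< re (herm H (v k) (v k)))
       × (p ℕ.≤ toℕ k → re (herm H (v k) (v k)) ℚ.< 0ℚ))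

-- The quadratic lattice L_Q: L as free ℤ-module of rank 2n, with ℤ-basis
-- e_1..e_n, i e_1..i e_n, and bilinear form (x,y) = Tr⟨x,y⟩.

zbasis : {n : ℕ} → Fin (n ℕ.+ n) → Lvec n
zbasis {n} a j with splitAt n a
... | inj₁ k = if eqF k j then ((+ 1) +iℤ (+ 0)) else ((+ 0) +iℤ (+ 0))
  where
  eqF : {m : ℕ} → Fin m → Fin m → Bool
  eqF zero zero = true
  eqF (suc x) (suc y) = eqF x y
  eqF _ _ = false
... | inj₂ k = if eqF k j then ((+ 0) +iℤ (+ 1)) else ((+ 0) +iℤ (+ 0))
  where
  eqF : {m : ℕ} → Fin m → Fin m → Bool
  eqF zero zero = true
  eqF (suc x) (suc y) = eqF x y
  eqF _ _ = false

gramLQ : {n : ℕ} → Mat F n n → Mat ℚ (n ℕ.+ n) (n ℕ.+ n)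
gramLQ H a b = Tr (herm H (emb (zbasis a)) (emb (zbasis b)))

δℤ : {m : ℕ} → Fin m → Fin m → ℤ
δℤ zero zero = + 1
δℤ (suc a) (suc b) = δℤ a b
δℤ _ _ = + 0

-- Isometry of lattices given by Gram matrices: a ℤ-basis change
-- P ∈ GL_m(ℤ) with Pᵀ G P = G'.
Isometric : {m : ℕ} → Mat ℚ m m → Mat ℤ m m → Set
Isometric {m} G G' = Σ (Mat ℤ m m) λ P → Σ (Mat ℤ m m) λ Q →
  (∀ i j → ℤsum (λ k → P i k ℤ.* Q k j) ≡ δℤ i j) ×
  (∀ i j → ℤsum (λ k → Q i k ℤ.* P k j) ≡ δℤ i j) ×
  (∀ k l → ℚsum (λ a → ℚsum (λ b →
        ℤ→ℚ (P a k) ℚ.* G a b ℚ.* ℤ→ℚ (P b l))) ≡ ℤ→ℚ (G' k l))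

_⊕ᴹ_ : {m n : ℕ} → Mat ℤ m m → Mat ℤ n n → Mat ℤ (m ℕ.+ n) (m ℕ.+ n)
_⊕ᴹ_ {m} A B i j with splitAt m i | splitAt m j
... | inj₁ a | inj₁ b = A a b
... | inj₂ a | inj₂ b = B a b
... | _      | _      = + 0

negᴹ : {m : ℕ} → Mat ℤ m m → Mat ℤ m m
negᴹ A i j = ℤ.- A i j

𝕌 : Mat ℤ 2 2
𝕌 zero zero = + 0
𝕌 zero (suc zero) = + 1
𝕌 (suc zero) zero = + 1
𝕌 (suc zero) (suc zero) = + 0

adjD6 : ℕ → ℕ → Bool
adjD6 0 1 = true
adjD6 1 2 = true
adjD6 2 3 = true
adjD6 3 4 = true
adjD6 3 5 = true
adjD6 _ _ = false

𝔻₆ : Mat ℤ 6 6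
𝔻₆ i j = if ⌊ toℕ i ≡ᵇ toℕ j ⌋ then + 2
         else (if adjD6 (toℕ i) (toℕ j) then ℤ.-[1+ 0 ]
         else (if adjD6 (toℕ j) (toℕ i) then ℤ.-[1+ 0 ] else + 0))
  where
  ⌊_≡ᵇ_⌋ : ℕ → ℕ → Bool
  ⌊ a ≡ᵇ b ⌋ = a ℕ.≡ᵇ b

UUD6 : Mat ℤ 10 10
UUD6 = 𝕌 ⊕ᴹ (𝕌 ⊕ᴹ negᴹ 𝔻₆)

{-# OPTIONS --safe #-}
-- Take the Hermitian form ½G on 𝒪_F⁵, where G is the Gaussian-integral Hermitian
-- matrix 𝕌 ⊕ A with A = [[-2, 1, 0], [1, -2, 1 - i], [0, 1 + i, -2]].  In the
-- ℤ-basis e_j, i e_j the Gram matrix of L_Q is [[Re G, Im G], [-Im G, Re G]], an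
-- even integral matrix; an explicit unimodular base change turns it into
-- 𝕌 ⊕ 𝕌 ⊕ 𝔻₆(-1).  Integrality of L_Q says exactly that ⟨L, L⟩ lies in the
-- inverse different ½𝒪_F, so 2⟨ℓ, r⟩ ∈ 𝒪_F holds for every r, not only for the
-- vectors of norm -1.  The signature is read off an explicit orthogonal F-basis
-- of norms 1, -1, -½, -½, -½.
module Submission where

open import Defs
open import Data.Product using (Σ; _×_; _,_; proj₁; proj₂)
open import Relation.Binary.PropositionalEquality
  using (_≡_; _≢_; refl; sym; trans; cong; cong₂; subst; module ≡-Reasoning)

open import Algebra.Core using (Op₂)
open import Algebra.Definitions using (Congruent₂)
open import Algebra.Morphism.Definitions using (Homomorphic₂)
import Algebra.Properties.Group
open import Data.Bool using (if_then_else_)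
open import Data.Fin as Fin using (Fin; zero; suc; toℕ; splitAt)
open import Data.Fin.Properties using (all?)
open import Data.Integer as ℤ using (ℤ; +_; -[1+_])
import Data.Integer.Tactic.RingSolver as ℤ-Solver
open import Data.Nat as ℕ using (ℕ; zero; suc; s≤s)
open import Data.Rational as ℚ using (ℚ; 0ℚ; 1ℚ; ½; -½)
import Data.Rational.Properties as ℚₚ
open import Data.Rational.Solver using (module +-*-Solver)
open import Data.Rational.Unnormalised using (ℚᵘ; mkℚᵘ; *≡*; _≃_)
import Data.Rational.Unnormalised.Properties as ℚᵘₚ
open import Data.Sum using (inj₁; inj₂)
open import Data.Vec using (Vec; []; _∷_; lookup)
open import Relation.Binary.Definitions using (DecidableEquality)
open import Relation.Nullary.Decidable
  using (True; toWitness; does; map′; _×-dec_; dec-true; dec-false)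

fromRows : {A : Set} {m n : ℕ} → Vec (Vec A n) m → Mat A m n
fromRows rows i j = lookup (lookup rows i) j

_≟F_ : DecidableEquality F
(a +i b) ≟F (c +i d) =
  map′ (λ { (refl , refl) → refl }) (λ { refl → refl , refl }) ((a ℚₚ.≟ c) ×-dec (b ℚₚ.≟ d))

decide-pointwise : {A : Set} (_≟_ : DecidableEquality A) {m n : ℕ} {f g : Mat A m n} →
  {yes : True (all? λ i → all? λ j → f i j ≟ g i j)} → ∀ i j → f i j ≡ g i j
decide-pointwise _ {yes = yes} = toWitness yes

module _ {_∙_ : Op₂ ℤ} {_∙ᵘ_ : Op₂ ℚᵘ} {_∙ℚ_ : Op₂ ℚ}
         (toℚᵘ-homo : Homomorphic₂ ℚ ℚᵘ _≃_ ℚ.toℚᵘ _∙ℚ_ _∙ᵘ_)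
         (∙ᵘ-cong : Congruent₂ _≃_ _∙ᵘ_)
         (homo-on-ℤ : ∀ a b → mkℚᵘ (a ∙ b) 0 ≃ mkℚᵘ a 0 ∙ᵘ mkℚᵘ b 0)
         where
  open ℚᵘₚ.≃-Reasoning
  open ℚᵘₚ using (≃-sym)

  ℤ→ℚ-homo : ∀ a b → ℤ→ℚ (a ∙ b) ≡ ℤ→ℚ a ∙ℚ ℤ→ℚ b
  ℤ→ℚ-homo a b = ℚₚ.toℚᵘ-injective (begin
    ℚ.toℚᵘ (ℤ→ℚ (a ∙ b))                ≈⟨ ℚₚ.toℚᵘ-fromℚᵘ (mkℚᵘ (a ∙ b) 0) ⟩
    mkℚᵘ (a ∙ b) 0                       ≈⟨ homo-on-ℤ a b ⟩
    mkℚᵘ a 0 ∙ᵘ mkℚᵘ b 0                 ≈⟨ ∙ᵘ-cong (≃-sym (ℚₚ.toℚᵘ-fromℚᵘ (mkℚᵘ a 0)))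
                                                    (≃-sym (ℚₚ.toℚᵘ-fromℚᵘ (mkℚᵘ b 0))) ⟩
    ℚ.toℚᵘ (ℤ→ℚ a) ∙ᵘ ℚ.toℚᵘ (ℤ→ℚ b)    ≈⟨ ≃-sym (toℚᵘ-homo (ℤ→ℚ a) (ℤ→ℚ b)) ⟩
    ℚ.toℚᵘ (ℤ→ℚ a ∙ℚ ℤ→ℚ b)             ∎)

ℤ→ℚ-homo-+ : ∀ a b → ℤ→ℚ (a ℤ.+ b) ≡ ℤ→ℚ a ℚ.+ ℤ→ℚ b
ℤ→ℚ-homo-+ = ℤ→ℚ-homo {ℤ._+_} ℚₚ.toℚᵘ-homo-+ ℚᵘₚ.+-cong (λ a b → *≡* (denominators-one a b))
  where
  denominators-one : ∀ a b → (a ℤ.+ b) ℤ.* (+ 1 ℤ.* + 1) ≡ (a ℤ.* + 1 ℤ.+ b ℤ.* + 1) ℤ.* + 1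
  denominators-one = ℤ-Solver.solve-∀

ℤ→ℚ-homo-* : ∀ a b → ℤ→ℚ (a ℤ.* b) ≡ ℤ→ℚ a ℚ.* ℤ→ℚ b
ℤ→ℚ-homo-* = ℤ→ℚ-homo {ℤ._*_} ℚₚ.toℚᵘ-homo-* ℚᵘₚ.*-cong (λ a b → *≡* (denominators-one a b))
  where
  denominators-one : ∀ a b → (a ℤ.* b) ℤ.* (+ 1 ℤ.* + 1) ≡ (a ℤ.* b) ℤ.* + 1
  denominators-one = ℤ-Solver.solve-∀

ℤ→ℚ-homo-neg : ∀ a → ℤ→ℚ (ℤ.- a) ≡ ℚ.- ℤ→ℚ a
ℤ→ℚ-homo-neg (+ zero)  = refl
ℤ→ℚ-homo-neg (+ suc n) = refl
ℤ→ℚ-homo-neg -[1+ n ]  = sym (-‿involutive (ℤ→ℚ (+ suc n)))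
  where open Algebra.Properties.Group ℚₚ.+-0-group using () renaming (⁻¹-involutive to -‿involutive)

ℤ→ℚ-ℤsum : ∀ {n} (f : Fin n → ℤ) → ℤ→ℚ (ℤsum f) ≡ ℚsum (λ i → ℤ→ℚ (f i))
ℤ→ℚ-ℤsum {zero}  f = refl
ℤ→ℚ-ℤsum {suc n} f = trans (ℤ→ℚ-homo-+ (f zero) _) (cong (ℤ→ℚ (f zero) ℚ.+_) (ℤ→ℚ-ℤsum (λ i → f (suc i))))

ℚsum-cong : ∀ {n} {f g : Fin n → ℚ} → (∀ i → f i ≡ g i) → ℚsum f ≡ ℚsum g
ℚsum-cong {zero}  _ = refl
ℚsum-cong {suc n} e = cong₂ ℚ._+_ (e zero) (ℚsum-cong (λ i → e (suc i)))

Fsum-cong : ∀ {n} {f g : Fin n → F} → (∀ i → f i ≡ g i) → Fsum f ≡ Fsum g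
Fsum-cong {zero}  _ = refl
Fsum-cong {suc n} e = cong₂ _+F_ (e zero) (Fsum-cong (λ i → e (suc i)))

IsInt-+ : ∀ {p q} → IsInt p → IsInt q → IsInt (p ℚ.+ q)
IsInt-+ (a , refl) (b , refl) = a ℤ.+ b , sym (ℤ→ℚ-homo-+ a b)

IsInt-* : ∀ {p q} → IsInt p → IsInt q → IsInt (p ℚ.* q)
IsInt-* (a , refl) (b , refl) = a ℤ.* b , sym (ℤ→ℚ-homo-* a b)

IsInt-neg : ∀ {p} → IsInt p → IsInt (ℚ.- p)
IsInt-neg (a , refl) = ℤ.- a , sym (ℤ→ℚ-homo-neg a)

InOF-ι : ∀ z → InOF (ι z)
InOF-ι (a +iℤ b) = (a , refl) , (b , refl)

InOF-+ : ∀ {z w} → InOF z → InOF w → InOF (z +F w)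
InOF-+ (a , b) (c , d) = IsInt-+ a c , IsInt-+ b d

InOF-* : ∀ {z w} → InOF z → InOF w → InOF (z *F w)
InOF-* (a , b) (c , d) = IsInt-+ (IsInt-* a c) (IsInt-neg (IsInt-* b d)) , IsInt-+ (IsInt-* a d) (IsInt-* b c)

InOF-conj : ∀ {z} → InOF z → InOF (conj z)
InOF-conj (a , b) = a , IsInt-neg b

InOF-Fsum : ∀ {n} {f : Fin n → F} → (∀ i → InOF (f i)) → InOF (Fsum f)
InOF-Fsum {zero}  _ = (+ 0 , refl) , (+ 0 , refl)
InOF-Fsum {suc n} f∈ = InOF-+ (f∈ zero) (InOF-Fsum (λ i → f∈ (suc i)))

module _ where
  open +-*-Solver using (solve; Polynomial; con; _:+_; _:*_; _:-_; _:=_)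

  -- Polynomials in pairs mirror _+F_ and _*F_ clause by clause, so every identity
  -- of F splits definitionally into two identities for the rational ring solver.
  infixl 6 _:+F_
  infixl 7 _:*F_
  _:+F_ _:*F_ : ∀ {n} → Polynomial n × Polynomial n → Polynomial n × Polynomial n →
                Polynomial n × Polynomial n
  (a , b) :+F (c , d) = (a :+ c) , (b :+ d)
  (a , b) :*F (c , d) = (a :* c :- b :* d) , (a :* d :+ b :* c)

  *F-zeroʳ : ∀ z → z *F 0F ≡ 0F
  *F-zeroʳ (a +i b) = cong₂ _+i_ (re-eq a b) (im-eq a b)
    where
    re-eq : ∀ a b → re ((a +i b) *F 0F) ≡ 0ℚ
    re-eq = solve 2 (λ a b → proj₁ ((a , b) :*F (con 0ℚ , con 0ℚ)) := con 0ℚ) refl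
    im-eq : ∀ a b → im ((a +i b) *F 0F) ≡ 0ℚ
    im-eq = solve 2 (λ a b → proj₂ ((a , b) :*F (con 0ℚ , con 0ℚ)) := con 0ℚ) refl

  *F-distribˡ-+F : ∀ z w u → z *F (w +F u) ≡ z *F w +F z *F u
  *F-distribˡ-+F (a +i b) (c +i d) (e +i f) = cong₂ _+i_ (re-eq a b c d e f) (im-eq a b c d e f)
    where
    re-eq : ∀ a b c d e f →
      re ((a +i b) *F ((c +i d) +F (e +i f))) ≡ re ((a +i b) *F (c +i d) +F (a +i b) *F (e +i f))
    re-eq = solve 6 (λ a b c d e f → proj₁ ((a , b) :*F ((c , d) :+F (e , f)))
                                  := proj₁ ((a , b) :*F (c , d) :+F (a , b) :*F (e , f))) refl
    im-eq : ∀ a b c d e f →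
      im ((a +i b) *F ((c +i d) +F (e +i f))) ≡ im ((a +i b) *F (c +i d) +F (a +i b) *F (e +i f))
    im-eq = solve 6 (λ a b c d e f → proj₂ ((a , b) :*F ((c , d) :+F (e , f)))
                                  := proj₂ ((a , b) :*F (c , d) :+F (a , b) :*F (e , f))) refl

  Tr≡re-2F* : ∀ z → Tr z ≡ re (2F *F z)
  Tr≡re-2F* (a +i b) = eq a b
    where
    eq : ∀ a b → Tr (a +i b) ≡ re (2F *F (a +i b))
    eq = solve 2 (λ a b → a :+ a := proj₁ ((con 1ℚ :+ con 1ℚ , con 0ℚ :+ con 0ℚ) :*F (a , b))) refl

  2F*-½-cancel : ∀ x g y → 2F *F (x *F ((½ +i 0ℚ) *F g) *F y) ≡ x *F g *F y
  2F*-½-cancel (a +i b) (c +i d) (e +i f) = cong₂ _+i_ (re-eq a b c d e f) (im-eq a b c d e f)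
    where
    2P ½P : ∀ {n} → Polynomial n × Polynomial n
    2P = con 1ℚ :+ con 1ℚ , con 0ℚ :+ con 0ℚ
    ½P = con ½ , con 0ℚ
    re-eq : ∀ a b c d e f →
      re (2F *F ((a +i b) *F ((½ +i 0ℚ) *F (c +i d)) *F (e +i f))) ≡ re ((a +i b) *F (c +i d) *F (e +i f))
    re-eq = solve 6 (λ a b c d e f → proj₁ (2P :*F ((a , b) :*F (½P :*F (c , d)) :*F (e , f)))
                                  := proj₁ ((a , b) :*F (c , d) :*F (e , f))) refl
    im-eq : ∀ a b c d e f →
      im (2F *F ((a +i b) *F ((½ +i 0ℚ) *F (c +i d)) *F (e +i f))) ≡ im ((a +i b) *F (c +i d) *F (e +i f))
    im-eq = solve 6 (λ a b c d e f → proj₂ (2P :*F ((a , b) :*F (½P :*F (c , d)) :*F (e , f)))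
                                  := proj₂ ((a , b) :*F (c , d) :*F (e , f))) refl

*F-distrib-Fsum : ∀ {n} z (f : Fin n → F) → z *F Fsum f ≡ Fsum (λ i → z *F f i)
*F-distrib-Fsum {zero}  z f = *F-zeroʳ z
*F-distrib-Fsum {suc n} z f =
  trans (*F-distribˡ-+F z (f zero) _) (cong (z *F f zero +F_) (*F-distrib-Fsum z (λ i → f (suc i))))

half : ∀ {n} → Mat 𝒪F n n → Mat F n n
half G i j = (½ +i 0ℚ) *F ι (G i j)

2F*-herm-half : ∀ {n} (G : Mat 𝒪F n n) (x y : Lvec n) →
  2F *F herm (half G) (emb x) (emb y) ≡ Fsum λ i → Fsum λ j → ι (x i) *F ι (G i j) *F conj (ι (y j))
2F*-herm-half {n} G x y = begin
  2F *F Fsum (λ i → Fsum λ j → term i j)        ≡⟨ *F-distrib-Fsum 2F (λ i → Fsum (term i)) ⟩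
  Fsum (λ i → 2F *F Fsum λ j → term i j)        ≡⟨ Fsum-cong (λ i → *F-distrib-Fsum 2F (term i)) ⟩
  Fsum (λ i → Fsum λ j → 2F *F term i j)        ≡⟨ Fsum-cong (λ i → Fsum-cong λ j →
                                                     2F*-½-cancel (ι (x i)) (ι (G i j)) (conj (ι (y j)))) ⟩
  Fsum (λ i → Fsum λ j → ι (x i) *F ι (G i j) *F conj (ι (y j))) ∎
  where
  open ≡-Reasoning
  term : Fin n → Fin n → F
  term i j = ι (x i) *F half G i j *F conj (ι (y j))

InOF-2F*-herm-half : ∀ {n} (G : Mat 𝒪F n n) (x y : Lvec n) → InOF (2F *F herm (half G) (emb x) (emb y))
InOF-2F*-herm-half G x y = subst InOF (sym (2F*-herm-half G x y))
  (InOF-Fsum λ i → InOF-Fsum λ j → InOF-* (InOF-* (InOF-ι (x i)) (InOF-ι (G i j))) (InOF-conj (InOF-ι (y j))))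

half-isHermitianLattice : ∀ {n} (G : Mat 𝒪F n n) → IsHermitianLattice (half G)
half-isHermitianLattice G x =
  subst IsInt (sym (Tr≡re-2F* (herm (half G) (emb x) (emb x)))) (proj₁ (InOF-2F*-herm-half G x x))

diagonal : ∀ {n} → (Fin n → F) → Mat F n n
diagonal d k l = if does (k Fin.≟ l) then d k else 0F

hasSignature-from-orthogonalBasis : ∀ {p q} (H : Mat F (p ℕ.+ q) (p ℕ.+ q))
  (v : Fin (p ℕ.+ q) → Fin (p ℕ.+ q) → F) (d : Fin (p ℕ.+ q) → ℚ) →
  IsFBasis v →
  (∀ k l → herm H (v k) (v l) ≡ diagonal (λ k → d k +i 0ℚ) k l) →
  (∀ k → (toℕ k ℕ.< p → 0ℚ ℚ.< d k) × (p ℕ.≤ toℕ k → d k ℚ.< 0ℚ)) →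
  HasSignature p q H
hasSignature-from-orthogonalBasis {p} {q} H v d basis gram signs =
  v , basis , orthogonal , (λ k → cong im (norm k)) , λ k → subst (signsOf k) (sym (norm k)) (signs k)
  where
  orthogonal : ∀ k l → k ≢ l → herm H (v k) (v l) ≡ 0F
  orthogonal k l k≢l = trans (gram k l) (cong (if_then d k +i 0ℚ else 0F) (dec-false (k Fin.≟ l) k≢l))
  norm : ∀ k → herm H (v k) (v k) ≡ d k +i 0ℚ
  norm k = trans (gram k k) (cong (if_then d k +i 0ℚ else 0F) (dec-true (k Fin.≟ k) refl))
  signsOf : Fin (p ℕ.+ q) → F → Set
  signsOf k z = (toℕ k ℕ.< p → 0ℚ ℚ.< re z) × (p ℕ.≤ toℕ k → re z ℚ.< 0ℚ)

gramLQ-half : ∀ {n} → Mat 𝒪F n n → Mat ℤ (n ℕ.+ n) (n ℕ.+ n)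
gramLQ-half {n} G a b with splitAt n a | splitAt n b
... | inj₁ i | inj₁ j = reℤ (G i j)
... | inj₁ i | inj₂ j = imℤ (G i j)
... | inj₂ i | inj₁ j = ℤ.- imℤ (G i j)
... | inj₂ i | inj₂ j = reℤ (G i j)

isometric-from-ℤ : ∀ {m} (G : Mat ℚ m m) (Gℤ G′ P Q : Mat ℤ m m) →
  (∀ a b → G a b ≡ ℤ→ℚ (Gℤ a b)) →
  (∀ i j → ℤsum (λ k → P i k ℤ.* Q k j) ≡ δℤ i j) →
  (∀ i j → ℤsum (λ k → Q i k ℤ.* P k j) ≡ δℤ i j) →
  (∀ k l → ℤsum (λ a → ℤsum (λ b → P a k ℤ.* Gℤ a b ℤ.* P b l)) ≡ G′ k l) →
  Isometric G G′
isometric-from-ℤ G Gℤ G′ P Q G≡Gℤ PQ≡I QP≡I PᵀGℤP≡G′ = P , Q , PQ≡I , QP≡I , λ k l → begin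
  ℚsum (λ a → ℚsum (λ b → ℤ→ℚ (P a k) ℚ.* G a b ℚ.* ℤ→ℚ (P b l)))
    ≡⟨ ℚsum-cong (λ a → ℚsum-cong (λ b → entry k l a b)) ⟩
  ℚsum (λ a → ℚsum (λ b → ℤ→ℚ (P a k ℤ.* Gℤ a b ℤ.* P b l)))
    ≡⟨ ℚsum-cong (λ a → sym (ℤ→ℚ-ℤsum (λ b → P a k ℤ.* Gℤ a b ℤ.* P b l))) ⟩
  ℚsum (λ a → ℤ→ℚ (ℤsum (λ b → P a k ℤ.* Gℤ a b ℤ.* P b l)))
    ≡⟨ sym (ℤ→ℚ-ℤsum (λ a → ℤsum (λ b → P a k ℤ.* Gℤ a b ℤ.* P b l))) ⟩
  ℤ→ℚ (ℤsum (λ a → ℤsum (λ b → P a k ℤ.* Gℤ a b ℤ.* P b l)))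
    ≡⟨ cong ℤ→ℚ (PᵀGℤP≡G′ k l) ⟩
  ℤ→ℚ (G′ k l) ∎
  where
  open ≡-Reasoning
  entry : ∀ k l a b → ℤ→ℚ (P a k) ℚ.* G a b ℚ.* ℤ→ℚ (P b l) ≡ ℤ→ℚ (P a k ℤ.* Gℤ a b ℤ.* P b l)
  entry k l a b = begin
    ℤ→ℚ (P a k) ℚ.* G a b ℚ.* ℤ→ℚ (P b l)            ≡⟨ cong (λ g → ℤ→ℚ (P a k) ℚ.* g ℚ.* ℤ→ℚ (P b l)) (G≡Gℤ a b) ⟩
    ℤ→ℚ (P a k) ℚ.* ℤ→ℚ (Gℤ a b) ℚ.* ℤ→ℚ (P b l)     ≡⟨ cong (ℚ._* ℤ→ℚ (P b l)) (sym (ℤ→ℚ-homo-* (P a k) (Gℤ a b))) ⟩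
    ℤ→ℚ (P a k ℤ.* Gℤ a b) ℚ.* ℤ→ℚ (P b l)           ≡⟨ sym (ℤ→ℚ-homo-* (P a k ℤ.* Gℤ a b) (P b l)) ⟩
    ℤ→ℚ (P a k ℤ.* Gℤ a b ℤ.* P b l)                 ∎

-- Overloaded numeric literals stay local to the integer data: in scope globally they
-- would also turn the arity argument of the ring solvers into an instance problem.
module _ where
  open import Agda.Builtin.FromNat using (fromNat)
  open import Agda.Builtin.FromNeg using (fromNeg)
  import Data.Integer.Literals as ℤLiterals
  import Data.Nat.Literals as ℕLiterals
  open import Data.Unit.Base using (tt)

  instance
    ℕ-number   = ℕLiterals.number
    ℤ-number   = ℤLiterals.number
    ℤ-negative = ℤLiterals.negative
    unit       = tt

  twiceGram : Mat 𝒪F 5 5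
  twiceGram = fromRows
    ( ((0 +iℤ 0) ∷ (1 +iℤ 0) ∷ ( 0 +iℤ 0) ∷ ( 0 +iℤ 0) ∷ ( 0 +iℤ  0) ∷ [])
    ∷ ((1 +iℤ 0) ∷ (0 +iℤ 0) ∷ ( 0 +iℤ 0) ∷ ( 0 +iℤ 0) ∷ ( 0 +iℤ  0) ∷ [])
    ∷ ((0 +iℤ 0) ∷ (0 +iℤ 0) ∷ (-2 +iℤ 0) ∷ ( 1 +iℤ 0) ∷ ( 0 +iℤ  0) ∷ [])
    ∷ ((0 +iℤ 0) ∷ (0 +iℤ 0) ∷ ( 1 +iℤ 0) ∷ (-2 +iℤ 0) ∷ ( 1 +iℤ -1) ∷ [])
    ∷ ((0 +iℤ 0) ∷ (0 +iℤ 0) ∷ ( 0 +iℤ 0) ∷ ( 1 +iℤ 1) ∷ (-2 +iℤ  0) ∷ [])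
    ∷ [])

  P : Mat ℤ 10 10
  P = fromRows
    ( ( 1 ∷  0 ∷  0 ∷  0 ∷  0 ∷  0 ∷  0 ∷  0 ∷  0 ∷  0 ∷ [])
    ∷ ( 0 ∷  1 ∷  0 ∷  0 ∷  0 ∷  0 ∷  0 ∷  0 ∷  0 ∷  0 ∷ [])
    ∷ ( 0 ∷  0 ∷  0 ∷  0 ∷  0 ∷  0 ∷  0 ∷  0 ∷ -1 ∷  1 ∷ [])
    ∷ ( 0 ∷  0 ∷  0 ∷  0 ∷  0 ∷  0 ∷  0 ∷ -1 ∷  0 ∷  2 ∷ [])
    ∷ ( 0 ∷  0 ∷  0 ∷  0 ∷ -1 ∷  0 ∷  0 ∷  0 ∷  0 ∷  1 ∷ [])
    ∷ ( 0 ∷  0 ∷  1 ∷  0 ∷  0 ∷  0 ∷  0 ∷  0 ∷  0 ∷  0 ∷ [])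
    ∷ ( 0 ∷  0 ∷  0 ∷  1 ∷  0 ∷  0 ∷  0 ∷  0 ∷  0 ∷  0 ∷ [])
    ∷ ( 0 ∷  0 ∷  0 ∷  0 ∷  0 ∷  0 ∷ -1 ∷  1 ∷  0 ∷  0 ∷ [])
    ∷ ( 0 ∷  0 ∷  0 ∷  0 ∷  0 ∷ -1 ∷  0 ∷  1 ∷  0 ∷  0 ∷ [])
    ∷ ( 0 ∷  0 ∷  0 ∷  0 ∷  0 ∷  0 ∷  0 ∷  1 ∷  0 ∷ -1 ∷ [])
    ∷ [])

  Q : Mat ℤ 10 10
  Q = fromRows
    ( ( 1 ∷  0 ∷  0 ∷  0 ∷  0 ∷  0 ∷  0 ∷  0 ∷  0 ∷  0 ∷ [])
    ∷ ( 0 ∷  1 ∷  0 ∷  0 ∷  0 ∷  0 ∷  0 ∷  0 ∷  0 ∷  0 ∷ [])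
    ∷ ( 0 ∷  0 ∷  0 ∷  0 ∷  0 ∷  1 ∷  0 ∷  0 ∷  0 ∷  0 ∷ [])
    ∷ ( 0 ∷  0 ∷  0 ∷  0 ∷  0 ∷  0 ∷  1 ∷  0 ∷  0 ∷  0 ∷ [])
    ∷ ( 0 ∷  0 ∷  0 ∷  1 ∷ -1 ∷  0 ∷  0 ∷  0 ∷  0 ∷  1 ∷ [])
    ∷ ( 0 ∷  0 ∷  0 ∷  1 ∷  0 ∷  0 ∷  0 ∷  0 ∷ -1 ∷  2 ∷ [])
    ∷ ( 0 ∷  0 ∷  0 ∷  1 ∷  0 ∷  0 ∷  0 ∷ -1 ∷  0 ∷  2 ∷ [])
    ∷ ( 0 ∷  0 ∷  0 ∷  1 ∷  0 ∷  0 ∷  0 ∷  0 ∷  0 ∷  2 ∷ [])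
    ∷ ( 0 ∷  0 ∷ -1 ∷  1 ∷  0 ∷  0 ∷  0 ∷  0 ∷  0 ∷  1 ∷ [])
    ∷ ( 0 ∷  0 ∷  0 ∷  1 ∷  0 ∷  0 ∷  0 ∷  0 ∷  0 ∷  1 ∷ [])
    ∷ [])

orthogonalBasis : Mat F 5 5
orthogonalBasis = fromRows
  ( (1F ∷ 1F      ∷ 0F ∷ 0F ∷ 0F ∷ [])
  ∷ (1F ∷ minus1F ∷ 0F ∷ 0F ∷ 0F ∷ [])
  ∷ (0F ∷ 0F      ∷ 1F ∷ 1F ∷ c  ∷ [])
  ∷ (0F ∷ 0F      ∷ 0F ∷ 1F ∷ c  ∷ [])
  ∷ (0F ∷ 0F      ∷ 0F ∷ 0F ∷ c  ∷ [])
  ∷ [])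
  where
  c : F
  c = ½ +i -½

orthogonalBasis⁻¹ : Mat F 5 5
orthogonalBasis⁻¹ = fromRows
  ( (½F ∷ ½F  ∷ 0F      ∷ 0F      ∷ 0F        ∷ [])
  ∷ (½F ∷ -½F ∷ 0F      ∷ 0F      ∷ 0F        ∷ [])
  ∷ (0F ∷ 0F  ∷ 1F      ∷ 0F      ∷ 0F        ∷ [])
  ∷ (0F ∷ 0F  ∷ minus1F ∷ 1F      ∷ 0F        ∷ [])
  ∷ (0F ∷ 0F  ∷ 0F      ∷ minus1F ∷ (1ℚ +i 1ℚ) ∷ [])
  ∷ [])
  where
  ½F -½F : F
  ½F  = ½ +i 0ℚ
  -½F = -½ +i 0ℚ

norms : Fin 5 → ℚ
norms zero          = 1ℚ
norms (suc zero)    = ℚ.- 1ℚ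
norms (suc (suc _)) = -½

signs : ∀ k → (toℕ k ℕ.< 1 → 0ℚ ℚ.< norms k) × (1 ℕ.≤ toℕ k → norms k ℚ.< 0ℚ)
signs zero          = (λ _ → ℚₚ.positive⁻¹ 1ℚ) , λ ()
signs (suc zero)    = (λ { (s≤s ()) }) , λ _ → ℚₚ.negative⁻¹ (ℚ.- 1ℚ)
signs (suc (suc _)) = (λ { (s≤s ()) }) , λ _ → ℚₚ.negative⁻¹ -½

propositionA4 : Σ (Mat F 5 5) λ H →
    IsHermitianMatrix H ×
    IsHermitianLattice H ×
    HasSignature 1 4 H ×
    Isometric (gramLQ H) UUD6 ×
    (∀ (l r : Lvec 5) → herm H (emb r) (emb r) ≡ minus1F →
      InOF (2F *F herm H (emb l) (emb r)))
propositionA4 =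
  half twiceGram ,
  decide-pointwise _≟F_ ,
  half-isHermitianLattice twiceGram ,
  hasSignature-from-orthogonalBasis (half twiceGram) orthogonalBasis norms
    (orthogonalBasis⁻¹ , decide-pointwise _≟F_) (decide-pointwise _≟F_) signs ,
  isometric-from-ℤ (gramLQ (half twiceGram)) (gramLQ-half twiceGram) UUD6 P Q
    (decide-pointwise ℚₚ._≟_) (decide-pointwise ℤ._≟_) (decide-pointwise ℤ._≟_) (decide-pointwise ℤ._≟_) ,
  λ l r _ → InOF-2F*-herm-half twiceGram l r
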